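{- Let $n$ be an even positive integer and $b$ a positive integer with $n-2b$ a positive (even) integer. If there exists a $(2,k_*,\lambda_*)$ orthogonal array and $4\lambda_*$ divides $b(n-b)$, then there exists a $k_*$-IMOFS$(n;n-2b)$.
   Context: A $(2,k_*,\lambda_*)$ orthogonal array is a $4\lambda_*\times k_*$ array with entries from a $2$-element set such that in every pair of distinct columns each of the $4$ ordered pairs of symbols occurs in exactly $\lambda_*$ rows. For positive even integers $s<n$, an incomplete frequency square of type $(n;s)$ is an $n\times n$ array indexed by $\{1,\dots,n\}^2$ whose cells in $\{1,\dots,s\}\times\{1,\dots,s\}$ are empty, whose other cells contain $0$ or $1$, and in which every row and every column contains equally many $0$'s and $1$'s. Two such arrays are orthogonal if, when superimposed (on the non-empty cells), each of the ordered pairs $(0,0),(0,1),(1,0),(1,1)$ occurs the same number of times. A $k$-IMOFS$(n;s)$ is a set of $k$ pairwise orthogonal incomplete frequency squares of type $(n;s)$. -}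

module Defs where

open import Data.Nat using (ℕ; zero; suc; _+_; _*_; _<_)
open import Data.Nat.Properties using (_<?_)
open import Data.Fin using (Fin; toℕ; zero; suc)
open import Data.Bool using (Bool; true; false; _∧_)
open import Data.Maybe using (Maybe; just; nothing)
open import Data.Product using (_×_) renaming (Σ to Σ′)
open import Relation.Binary.PropositionalEquality using (_≡_; _≢_)
open import Relation.Nullary.Decidable using (⌊_⌋)

b2n : Bool → ℕ
b2n true  = 1
b2n false = 0

count : ∀ {m} → (Fin m → Bool) → ℕ
count {zero}  p = 0
count {suc m} p = b2n (p zero) + count (λ i → p (suc i))

sumFin : ∀ {m} → (Fin m → ℕ) → ℕ
sumFin {zero}  f = 0
sumFin {suc m} f = f zero + sumFin (λ i → f (suc i))

count2 : ∀ {m} → (Fin m → Fin m → Bool) → ℕ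
count2 p = sumFin (λ i → count (p i))

_==ᵇ_ : Bool → Bool → Bool
true  ==ᵇ true  = true
false ==ᵇ false = true
_     ==ᵇ _     = false

is : Maybe Bool → Bool → Bool
is nothing  a = false
is (just x) a = x ==ᵇ a

IsOA : (k lam : ℕ) → (Fin (4 * lam) → Fin k → Bool) → Set
IsOA k lam A =
  ∀ (c c′ : Fin k) → c ≢ c′ → ∀ (a a′ : Bool) →
    count (λ r → (A r c ==ᵇ a) ∧ (A r c′ ==ᵇ a′)) ≡ lam

OrthogonalArray : (k lam : ℕ) → Set
OrthogonalArray k lam = Σ′ (Fin (4 * lam) → Fin k → Bool) (IsOA k lam)

-- Incomplete frequency squares of type (n; s), symbols Bool (false = 0,
-- true = 1), rows/columns indexed by Fin n (index i stands for i+1),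
-- empty cells represented by nothing.

inHole : ∀ {n} (s : ℕ) → Fin n → Fin n → Bool
inHole s i j = ⌊ toℕ i <? s ⌋ ∧ ⌊ toℕ j <? s ⌋

record IsIFS (n s : ℕ) (F : Fin n → Fin n → Maybe Bool) : Set where
  field
    empty-hole   : ∀ i j → inHole s i j ≡ true → F i j ≡ nothing
    filled-else  : ∀ i j → inHole s i j ≡ false → Σ′ Bool (λ x → F i j ≡ just x)
    row-balanced : ∀ i → count (λ j → is (F i j) false) ≡ count (λ j → is (F i j) true)
    col-balanced : ∀ j → count (λ i → is (F i j) false) ≡ count (λ i → is (F i j) true)

pairCount : ∀ {n} → (F G : Fin n → Fin n → Maybe Bool) → Bool → Bool → ℕ
pairCount F G a a′ = count2 (λ i j → is (F i j) a ∧ is (G i j) a′)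

Orthogonal : ∀ {n} → (F G : Fin n → Fin n → Maybe Bool) → Set
Orthogonal F G = ∀ (a a′ b b′ : Bool) → pairCount F G a a′ ≡ pairCount F G b b′

record IMOFS (k n s : ℕ) : Set where
  field
    square     : Fin k → Fin n → Fin n → Maybe Bool
    isIFS      : ∀ t → IsIFS n s (square t)
    orthogonal : ∀ t u → t ≢ u → Orthogonal (square t) (square u)

module Submission where

-- Write n = 2(h + b), so the hole has side 2h, and view the square as an (h + b) × (h + b) array
-- of 2 × 2 blocks, the hole being the top-left h × h corner.  Each of the (h + b)² − h² = b(n − b)
-- other blocks becomes [[x , ¬x] , [¬x , x]], where square t takes x from column t of one row of
-- the orthogonal array; such blocks have balanced rows and columns.  Two squares t ≠ u then show
-- (x , y) twice and (¬x , ¬y) twice on a block built from a row with entries (x , y).  Since 4λ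
-- divides b(n − b), numbering the blocks and using OA row (number mod 4λ) uses every row equally
-- often, q times say, so every ordered pair of symbols appears 4qλ times.

open import Defs
open import Algebra.Properties.CommutativeSemigroup using (interchange)
open import Data.Bool using (Bool; true; false; not; _∧_; _xor_; if_then_else_)
open import Data.Bool.Properties using (xor-comm)
open import Data.Fin using (Fin; toℕ; zero; suc)
open import Data.Fin.Properties using (toℕ-fromℕ<; toℕ-injective; toℕ<n)
open import Data.Maybe using (Maybe; just; nothing)
import Data.Maybe as Maybe
open import Data.Nat using (ℕ; zero; suc; _+_; _*_; _∸_; _<_; _≤_; z<s; s<s; ⌊_/2⌋; NonZero; >-nonZero)
open import Data.Nat.DivMod using (_%_; _mod_; [m+kn]%n≡m%n; m<n⇒m%n≡m)
open import Data.Nat.Divisibility using (_∣_; divides)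
open import Data.Nat.Properties
open import Data.Nat.Tactic.RingSolver using (solve-∀)
open import Data.Product using (∃-syntax; _,_)
open import Function using (_∘_; mk⇔)
open import Relation.Binary.PropositionalEquality
open import Relation.Nullary using (Dec; ¬_)
open import Relation.Nullary.Decidable using (⌊_⌋; does; isYes≗does; does-⇔; dec-true; dec-false)

open ≡-Reasoning

sumTo : ℕ → (ℕ → ℕ) → ℕ
sumTo zero    f = 0
sumTo (suc n) f = f 0 + sumTo n (f ∘ suc)

sumTo-cong : ∀ n {f g : ℕ → ℕ} → (∀ i → i < n → f i ≡ g i) → sumTo n f ≡ sumTo n g
sumTo-cong zero    f≡g = refl
sumTo-cong (suc n) f≡g = cong₂ _+_ (f≡g 0 z<s) (sumTo-cong n (λ i i<n → f≡g (suc i) (s<s i<n)))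

sumTo-const : ∀ n x → sumTo n (λ _ → x) ≡ n * x
sumTo-const zero    x = refl
sumTo-const (suc n) x = cong (x +_) (sumTo-const n x)

sumTo-+ : ∀ n (f g : ℕ → ℕ) → sumTo n (λ i → f i + g i) ≡ sumTo n f + sumTo n g
sumTo-+ zero    f g = refl
sumTo-+ (suc n) f g = begin
  f 0 + g 0 + sumTo n (λ i → f (suc i) + g (suc i))      ≡⟨ cong (f 0 + g 0 +_) (sumTo-+ n (f ∘ suc) (g ∘ suc)) ⟩
  f 0 + g 0 + (sumTo n (f ∘ suc) + sumTo n (g ∘ suc))    ≡⟨ interchange +-commutativeSemigroup (f 0) (g 0) _ _ ⟩
  f 0 + sumTo n (f ∘ suc) + (g 0 + sumTo n (g ∘ suc))    ∎

sumTo-++ : ∀ a c (f : ℕ → ℕ) → sumTo (a + c) f ≡ sumTo a f + sumTo c (λ i → f (a + i))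
sumTo-++ zero    c f = refl
sumTo-++ (suc a) c f = trans (cong (f 0 +_) (sumTo-++ a c (f ∘ suc))) (sym (+-assoc (f 0) _ _))

sumTo-* : ∀ a c (f : ℕ → ℕ) → sumTo (a * c) f ≡ sumTo a (λ I → sumTo c (λ J → f (I * c + J)))
sumTo-* zero    c f = refl
sumTo-* (suc a) c f = begin
  sumTo (c + a * c) f
    ≡⟨ sumTo-++ c (a * c) f ⟩
  sumTo c f + sumTo (a * c) (λ p → f (c + p))
    ≡⟨ cong (sumTo c f +_) (sumTo-* a c (λ p → f (c + p))) ⟩
  sumTo c f + sumTo a (λ I → sumTo c (λ J → f (c + (I * c + J))))
    ≡⟨ cong (sumTo c f +_) (sumTo-cong a (λ I _ → sumTo-cong c (λ J _ → cong f (sym (+-assoc c (I * c) J))))) ⟩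
  sumTo c f + sumTo a (λ I → sumTo c (λ J → f (c + I * c + J))) ∎

sumFin≡sumTo : ∀ {m} {f : Fin m → ℕ} {g : ℕ → ℕ} → (∀ i → f i ≡ g (toℕ i)) → sumFin f ≡ sumTo m g
sumFin≡sumTo {zero}  f≡g = refl
sumFin≡sumTo {suc m} f≡g = cong₂ _+_ (f≡g zero) (sumFin≡sumTo (f≡g ∘ suc))

sumFin-+ : ∀ {m} (f g : Fin m → ℕ) → sumFin (λ i → f i + g i) ≡ sumFin f + sumFin g
sumFin-+ {zero}  f g = refl
sumFin-+ {suc m} f g = begin
  f zero + g zero + sumFin (λ i → f (suc i) + g (suc i))       ≡⟨ cong (f zero + g zero +_) (sumFin-+ (f ∘ suc) (g ∘ suc)) ⟩
  f zero + g zero + (sumFin (f ∘ suc) + sumFin (g ∘ suc))     ≡⟨ interchange +-commutativeSemigroup (f zero) (g zero) _ _ ⟩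
  f zero + sumFin (f ∘ suc) + (g zero + sumFin (g ∘ suc))     ∎

count≡sumFin : ∀ {m} (p : Fin m → Bool) → count p ≡ sumFin (b2n ∘ p)
count≡sumFin {zero}  p = refl
count≡sumFin {suc m} p = cong (b2n (p zero) +_) (count≡sumFin (p ∘ suc))

count-cong : ∀ {m} {p q : Fin m → Bool} → (∀ i → p i ≡ q i) → count p ≡ count q
count-cong {zero}  p≡q = refl
count-cong {suc m} p≡q = cong₂ _+_ (cong b2n (p≡q zero)) (count-cong (p≡q ∘ suc))

count≡sumTo : ∀ m (p : ℕ → Bool) → count {m} (p ∘ toℕ) ≡ sumTo m (b2n ∘ p)
count≡sumTo m p = trans (count≡sumFin {m} (p ∘ toℕ)) (sumFin≡sumTo {m} (λ _ → refl))

count2≡sumTo : ∀ m (p : ℕ → ℕ → Bool) →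
  count2 {m} (λ i j → p (toℕ i) (toℕ j)) ≡ sumTo m (λ i → sumTo m (λ j → b2n (p i j)))
count2≡sumTo m p = sumFin≡sumTo {m} (λ i → count≡sumTo m (p (toℕ i)))

[I*c+r]mod-c≡r : ∀ {c} .{{_ : NonZero c}} I (r : Fin c) → (I * c + toℕ r) mod c ≡ r
[I*c+r]mod-c≡r {c} I r = toℕ-injective (begin
  toℕ ((I * c + toℕ r) mod c)   ≡⟨ toℕ-fromℕ< _ ⟩
  (I * c + toℕ r) % c           ≡⟨ cong (_% c) (+-comm (I * c) (toℕ r)) ⟩
  (toℕ r + I * c) % c           ≡⟨ [m+kn]%n≡m%n (toℕ r) I c ⟩
  toℕ r % c                     ≡⟨ m<n⇒m%n≡m (toℕ<n r) ⟩
  toℕ r                         ∎)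

sumTo-mod : ∀ q c .{{_ : NonZero c}} (f : Fin c → ℕ) → sumTo (q * c) (λ p → f (p mod c)) ≡ q * sumFin f
sumTo-mod q c f = begin
  sumTo (q * c) (λ p → f (p mod c))
    ≡⟨ sumTo-* q c _ ⟩
  sumTo q (λ I → sumTo c (λ J → f ((I * c + J) mod c)))
    ≡⟨ sumTo-cong q (λ I _ → sym (sumFin≡sumTo (λ r → cong f (sym ([I*c+r]mod-c≡r I r))))) ⟩
  sumTo q (λ _ → sumFin f)
    ≡⟨ sumTo-const q (sumFin f) ⟩
  q * sumFin f ∎

isOdd : ℕ → Bool
isOdd zero          = false
isOdd (suc zero)    = true
isOdd (suc (suc n)) = isOdd n

bit : ℕ → Bool → ℕ
bit I d = b2n d + I * 2

⌊bit/2⌋≡ : ∀ I d → ⌊ bit I d /2⌋ ≡ I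
⌊bit/2⌋≡ zero    false = refl
⌊bit/2⌋≡ zero    true  = refl
⌊bit/2⌋≡ (suc I) false = cong suc (⌊bit/2⌋≡ I false)
⌊bit/2⌋≡ (suc I) true  = cong suc (⌊bit/2⌋≡ I true)

isOdd-bit : ∀ I d → isOdd (bit I d) ≡ d
isOdd-bit zero    false = refl
isOdd-bit zero    true  = refl
isOdd-bit (suc I) false = isOdd-bit I false
isOdd-bit (suc I) true  = isOdd-bit I true

⌊/2⌋<⇒<*2 : ∀ i h → ⌊ i /2⌋ < h → i < h * 2
⌊/2⌋<⇒<*2 zero          (suc h) _         = z<s
⌊/2⌋<⇒<*2 (suc zero)    (suc h) _         = s<s z<s
⌊/2⌋<⇒<*2 (suc (suc i)) (suc h) (s<s i<h) = s<s (s<s (⌊/2⌋<⇒<*2 i h i<h))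

<*2⇒⌊/2⌋< : ∀ i h → i < h * 2 → ⌊ i /2⌋ < h
<*2⇒⌊/2⌋< zero          (suc h) _               = z<s
<*2⇒⌊/2⌋< (suc zero)    (suc h) _               = z<s
<*2⇒⌊/2⌋< (suc (suc i)) (suc h) (s<s (s<s i<h)) = s<s (<*2⇒⌊/2⌋< i h i<h)

⌊⌋≡true : ∀ {A : Set} (a? : Dec A) → A → ⌊ a? ⌋ ≡ true
⌊⌋≡true a? a = trans (isYes≗does a?) (dec-true a? a)

⌊⌋≡false : ∀ {A : Set} (a? : Dec A) → ¬ A → ⌊ a? ⌋ ≡ false
⌊⌋≡false a? ¬a = trans (isYes≗does a?) (dec-false a? ¬a)

⌊<?*2⌋≡⌊⌊/2⌋<?⌋ : ∀ i h → ⌊ i <? h * 2 ⌋ ≡ ⌊ ⌊ i /2⌋ <? h ⌋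
⌊<?*2⌋≡⌊⌊/2⌋<?⌋ i h = begin
  ⌊ i <? h * 2 ⌋        ≡⟨ isYes≗does (i <? h * 2) ⟩
  does (i <? h * 2)      ≡⟨ does-⇔ (mk⇔ (<*2⇒⌊/2⌋< i h) (⌊/2⌋<⇒<*2 i h)) (i <? h * 2) (⌊ i /2⌋ <? h) ⟩
  does (⌊ i /2⌋ <? h)    ≡⟨ sym (isYes≗does (⌊ i /2⌋ <? h)) ⟩
  ⌊ ⌊ i /2⌋ <? h ⌋      ∎

sumTo-pairs : ∀ m (f : ℕ → ℕ) → sumTo (m * 2) f ≡ sumTo m (λ I → f (bit I false) + f (bit I true))
sumTo-pairs zero    f = refl
sumTo-pairs (suc m) f =
  trans (cong (λ s → f 0 + (f 1 + s)) (sumTo-pairs m (λ i → f (suc (suc i))))) (sym (+-assoc (f 0) (f 1) _))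

sumTo²-pairs : ∀ m (f : ℕ → ℕ → ℕ) →
  sumTo (m * 2) (λ i → sumTo (m * 2) (f i)) ≡
  sumTo m (λ I → sumTo m (λ J → (f (bit I false) (bit J false) + f (bit I false) (bit J true))
                              + (f (bit I true)  (bit J false) + f (bit I true)  (bit J true))))
sumTo²-pairs m f = trans (sumTo-pairs m (λ i → sumTo (m * 2) (f i))) (sumTo-cong m (λ I _ → begin
  sumTo (m * 2) (f (bit I false)) + sumTo (m * 2) (f (bit I true))
    ≡⟨ cong₂ _+_ (sumTo-pairs m (f (bit I false))) (sumTo-pairs m (f (bit I true))) ⟩
  sumTo m (pair (bit I false)) + sumTo m (pair (bit I true))
    ≡⟨ sym (sumTo-+ m (pair (bit I false)) (pair (bit I true))) ⟩
  sumTo m (λ J → pair (bit I false) J + pair (bit I true) J) ∎))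
  where
  pair : ℕ → ℕ → ℕ
  pair i J = f i (bit J false) + f i (bit J true)

twist : Bool → Maybe Bool → Maybe Bool
twist e = Maybe.map (e xor_)

-- Replaces each entry just x of the block array B by the 2 × 2 block [[x , not x] , [not x , x]],
-- and each nothing by an empty 2 × 2 block.
inflate : (ℕ → ℕ → Maybe Bool) → ℕ → ℕ → Maybe Bool
inflate B i j = twist (isOdd i xor isOdd j) (B ⌊ i /2⌋ ⌊ j /2⌋)

inflate-bitˡ : ∀ B I j d → inflate B (bit I d) j ≡ twist (d xor isOdd j) (B I ⌊ j /2⌋)
inflate-bitˡ B I j d rewrite ⌊bit/2⌋≡ I d | isOdd-bit I d = refl

inflate-bitʳ : ∀ B i J d → inflate B i (bit J d) ≡ twist (d xor isOdd i) (B ⌊ i /2⌋ J)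
inflate-bitʳ B i J d rewrite ⌊bit/2⌋≡ J d | isOdd-bit J d | xor-comm (isOdd i) d = refl

inflate-bit : ∀ B I J di dj → inflate B (bit I di) (bit J dj) ≡ twist (di xor dj) (B I J)
inflate-bit B I J di dj = trans (inflate-bitˡ B I (bit J dj) di)
  (cong₂ (λ e J′ → twist (di xor e) (B I J′)) (isOdd-bit J dj) (⌊bit/2⌋≡ J dj))

Balanced : Maybe Bool → Maybe Bool → Set
Balanced x y = b2n (is x false) + b2n (is y false) ≡ b2n (is x true) + b2n (is y true)

twist-balanced : ∀ e x → Balanced (twist e x) (twist (not e) x)
twist-balanced e     nothing      = refl
twist-balanced false (just false) = refl
twist-balanced false (just true)  = refl
twist-balanced true  (just false) = refl
twist-balanced true  (just true)  = refl

sumTo-balanced : ∀ m (x : ℕ → Maybe Bool) → (∀ J → Balanced (x (bit J false)) (x (bit J true))) →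
  sumTo (m * 2) (λ j → b2n (is (x j) false)) ≡ sumTo (m * 2) (λ j → b2n (is (x j) true))
sumTo-balanced m x balanced = begin
  sumTo (m * 2) (λ j → b2n (is (x j) false))                                 ≡⟨ sumTo-pairs m _ ⟩
  sumTo m (λ J → b2n (is (x (bit J false)) false) + b2n (is (x (bit J true)) false)) ≡⟨ sumTo-cong m (λ J _ → balanced J) ⟩
  sumTo m (λ J → b2n (is (x (bit J false)) true) + b2n (is (x (bit J true)) true))   ≡⟨ sumTo-pairs m _ ⟨
  sumTo (m * 2) (λ j → b2n (is (x j) true))                                  ∎

inflate-rowBalanced : ∀ m B i →
  sumTo (m * 2) (λ j → b2n (is (inflate B i j) false)) ≡ sumTo (m * 2) (λ j → b2n (is (inflate B i j) true))
inflate-rowBalanced m B i = sumTo-balanced m (inflate B i) λ J →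
  subst₂ Balanced (sym (inflate-bitʳ B i J false)) (sym (inflate-bitʳ B i J true))
         (twist-balanced (isOdd i) (B ⌊ i /2⌋ J))

inflate-colBalanced : ∀ m B j →
  sumTo (m * 2) (λ i → b2n (is (inflate B i j) false)) ≡ sumTo (m * 2) (λ i → b2n (is (inflate B i j) true))
inflate-colBalanced m B j = sumTo-balanced m (λ i → inflate B i j) λ I →
  subst₂ Balanced (sym (inflate-bitˡ B I j false)) (sym (inflate-bitˡ B I j true))
         (twist-balanced (isOdd j) (B I ⌊ j /2⌋))

agrees : Bool → Bool → Maybe Bool → Maybe Bool → ℕ
agrees a a′ x y = b2n (is x a ∧ is y a′)

blockAgreements : Bool → Bool → Maybe Bool → Maybe Bool → ℕ
blockAgreements a a′ x y = (agreesAt false + agreesAt true) + (agreesAt true + agreesAt false)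
  where
  agreesAt : Bool → ℕ
  agreesAt e = agrees a a′ (twist e x) (twist e y)

inflate-agreements : ∀ m B B′ a a′ →
  sumTo (m * 2) (λ i → sumTo (m * 2) (λ j → agrees a a′ (inflate B i j) (inflate B′ i j))) ≡
  sumTo m (λ I → sumTo m (λ J → blockAgreements a a′ (B I J) (B′ I J)))
inflate-agreements m B B′ a a′ =
  trans (sumTo²-pairs m (λ i j → agrees a a′ (inflate B i j) (inflate B′ i j)))
        (sumTo-cong m λ I _ → sumTo-cong m λ J _ →
          cong₂ _+_ (cong₂ _+_ (atBit I J false false) (atBit I J false true))
                    (cong₂ _+_ (atBit I J true false) (atBit I J true true)))
  where
  atBit : ∀ I J di dj → agrees a a′ (inflate B (bit I di) (bit J dj)) (inflate B′ (bit I di) (bit J dj))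
                      ≡ agrees a a′ (twist (di xor dj) (B I J)) (twist (di xor dj) (B′ I J))
  atBit I J di dj = cong₂ (agrees a a′) (inflate-bit B I J di dj) (inflate-bit B′ I J di dj)

not-==ᵇ : ∀ x a → (not x ==ᵇ a) ≡ (x ==ᵇ not a)
not-==ᵇ false false = refl
not-==ᵇ false true  = refl
not-==ᵇ true  false = refl
not-==ᵇ true  true  = refl

columnPair-agreements : ∀ {c} (x y : Fin c → Bool) {L} →
  (∀ a a′ → count (λ r → (x r ==ᵇ a) ∧ (y r ==ᵇ a′)) ≡ L) →
  ∀ a a′ → sumFin (λ r → blockAgreements a a′ (just (x r)) (just (y r))) ≡ (L + L) + (L + L)
columnPair-agreements {c} x y {L} uniform a a′ = begin
  sumFin (λ r → (straight r + flipped r) + (flipped r + straight r))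
    ≡⟨ sumFin-+ (λ r → straight r + flipped r) (λ r → flipped r + straight r) ⟩
  sumFin (λ r → straight r + flipped r) + sumFin (λ r → flipped r + straight r)
    ≡⟨ cong₂ _+_ (sumFin-+ straight flipped) (sumFin-+ flipped straight) ⟩
  (sumFin straight + sumFin flipped) + (sumFin flipped + sumFin straight)
    ≡⟨ cong₂ _+_ (cong₂ _+_ straight≡L flipped≡L) (cong₂ _+_ flipped≡L straight≡L) ⟩
  (L + L) + (L + L) ∎
  where
  straight flipped : Fin c → ℕ
  straight r = agrees a a′ (just (x r)) (just (y r))
  flipped r = agrees a a′ (just (not (x r))) (just (not (y r)))
  straight≡L : sumFin straight ≡ L
  straight≡L = trans (sym (count≡sumFin (λ r → (x r ==ᵇ a) ∧ (y r ==ᵇ a′)))) (uniform a a′)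
  flipped≡L : sumFin flipped ≡ L
  flipped≡L = begin
    sumFin flipped                                              ≡⟨ count≡sumFin (λ r → (not (x r) ==ᵇ a) ∧ (not (y r) ==ᵇ a′)) ⟨
    count (λ r → (not (x r) ==ᵇ a) ∧ (not (y r) ==ᵇ a′))       ≡⟨ count-cong (λ r → cong₂ _∧_ (not-==ᵇ (x r) a) (not-==ᵇ (y r) a′)) ⟩
    count (λ r → (x r ==ᵇ not a) ∧ (y r ==ᵇ not a′))           ≡⟨ uniform (not a) (not a′) ⟩
    L                                                           ∎

module BlockEnumeration (h b : ℕ) where

  isHoleBlock : ℕ → ℕ → Bool
  isHoleBlock I J = ⌊ I <? h ⌋ ∧ ⌊ J <? h ⌋

  -- Numbers the non-hole blocks 0, 1, … : first the h × b blocks right of the hole, then the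
  -- b × (h + b) blocks below it, both row by row; the truncated subtractions never truncate there.
  blockIndex : ℕ → ℕ → ℕ
  blockIndex I J = if ⌊ I <? h ⌋ then I * b + (J ∸ h) else h * b + ((I ∸ h) * (h + b) + J)

  sumTo-nonHoleBlocks : ∀ (Φ : ℕ → ℕ) →
    sumTo (h + b) (λ I → sumTo (h + b) (λ J → if isHoleBlock I J then 0 else Φ (blockIndex I J)))
    ≡ sumTo (h * b + b * (h + b)) Φ
  sumTo-nonHoleBlocks Φ = begin
    sumTo (h + b) row
      ≡⟨ sumTo-++ h b row ⟩
    sumTo h row + sumTo b (λ I → row (h + I))
      ≡⟨ cong₂ _+_ (sumTo-cong h upperRow) (sumTo-cong b (λ I _ → lowerRow I)) ⟩
    sumTo h (λ I → sumTo b (λ J → Φ (I * b + J))) + sumTo b (λ I → sumTo (h + b) (λ J → Φ (h * b + (I * (h + b) + J))))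
      ≡⟨ cong₂ _+_ (sumTo-* h b Φ) (sumTo-* b (h + b) (λ p → Φ (h * b + p))) ⟨
    sumTo (h * b) Φ + sumTo (b * (h + b)) (λ p → Φ (h * b + p))
      ≡⟨ sumTo-++ (h * b) (b * (h + b)) Φ ⟨
    sumTo (h * b + b * (h + b)) Φ ∎
    where
    cell : ℕ → ℕ → ℕ
    cell I J = if isHoleBlock I J then 0 else Φ (blockIndex I J)
    row : ℕ → ℕ
    row I = sumTo (h + b) (cell I)

    hole : ∀ I J → I < h → J < h → cell I J ≡ 0
    hole I J I<h J<h rewrite ⌊⌋≡true (I <? h) I<h | ⌊⌋≡true (J <? h) J<h = refl

    right : ∀ I J → I < h → cell I (h + J) ≡ Φ (I * b + J)
    right I J I<h rewrite ⌊⌋≡true (I <? h) I<h | ⌊⌋≡false (h + J <? h) (m+n≮m h J) | m+n∸m≡n h J = refl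

    below : ∀ I J → cell (h + I) J ≡ Φ (h * b + (I * (h + b) + J))
    below I J rewrite ⌊⌋≡false (h + I <? h) (m+n≮m h I) | m+n∸m≡n h I = refl

    upperRow : ∀ I → I < h → row I ≡ sumTo b (λ J → Φ (I * b + J))
    upperRow I I<h = begin
      row I                                                ≡⟨ sumTo-++ h b (cell I) ⟩
      sumTo h (cell I) + sumTo b (λ J → cell I (h + J))    ≡⟨ cong₂ _+_ holePart (sumTo-cong b (λ J _ → right I J I<h)) ⟩
      0 + sumTo b (λ J → Φ (I * b + J))                    ∎
      where
      holePart : sumTo h (cell I) ≡ 0
      holePart = trans (sumTo-cong h (λ J J<h → hole I J I<h J<h)) (trans (sumTo-const h 0) (*-zeroʳ h))

    lowerRow : ∀ I → row (h + I) ≡ sumTo (h + b) (λ J → Φ (h * b + (I * (h + b) + J)))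
    lowerRow I = sumTo-cong (h + b) (λ J _ → below I J)

fill : Bool → Bool → Maybe Bool
fill empty x = if empty then nothing else just x

fill-empty : ∀ {empty} x → empty ≡ true → fill empty x ≡ nothing
fill-empty x refl = refl

fill-filled : ∀ {empty} x → empty ≡ false → fill empty x ≡ just x
fill-filled x refl = refl

blockAgreements-fill : ∀ a a′ empty x y →
  blockAgreements a a′ (fill empty x) (fill empty y) ≡ (if empty then 0 else blockAgreements a a′ (just x) (just y))
blockAgreements-fill a a′ true  x y = refl
blockAgreements-fill a a′ false x y = refl

module BlockConstruction (h b : ℕ) {c k : ℕ} .{{_ : NonZero c}} (A : Fin c → Fin k → Bool) where

  open BlockEnumeration h b

  block : Fin k → ℕ → ℕ → Maybe Bool
  block t I J = fill (isHoleBlock I J) (A (blockIndex I J mod c) t)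

  square : Fin k → Fin ((h + b) * 2) → Fin ((h + b) * 2) → Maybe Bool
  square t i j = inflate (block t) (toℕ i) (toℕ j)

  inHole≡isHoleBlock : ∀ (i j : Fin ((h + b) * 2)) → inHole (h * 2) i j ≡ isHoleBlock ⌊ toℕ i /2⌋ ⌊ toℕ j /2⌋
  inHole≡isHoleBlock i j = cong₂ _∧_ (⌊<?*2⌋≡⌊⌊/2⌋<?⌋ (toℕ i) h) (⌊<?*2⌋≡⌊⌊/2⌋<?⌋ (toℕ j) h)

  square-isIFS : ∀ t → IsIFS ((h + b) * 2) (h * 2) (square t)
  square-isIFS t = record
    { empty-hole   = λ i j inside → cong (twistAt i j) (fill-empty _ (trans (sym (inHole≡isHoleBlock i j)) inside))
    ; filled-else  = λ i j outside → _ , cong (twistAt i j) (fill-filled _ (trans (sym (inHole≡isHoleBlock i j)) outside))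
    ; row-balanced = λ i → begin
        count (λ j → is (square t i j) false)                         ≡⟨ count≡sumTo n (λ j → is (inflate (block t) (toℕ i) j) false) ⟩
        sumTo n (λ j → b2n (is (inflate (block t) (toℕ i) j) false))  ≡⟨ inflate-rowBalanced (h + b) (block t) (toℕ i) ⟩
        sumTo n (λ j → b2n (is (inflate (block t) (toℕ i) j) true))   ≡⟨ count≡sumTo n (λ j → is (inflate (block t) (toℕ i) j) true) ⟨
        count (λ j → is (square t i j) true)                          ∎
    ; col-balanced = λ j → begin
        count (λ i → is (square t i j) false)                         ≡⟨ count≡sumTo n (λ i → is (inflate (block t) i (toℕ j)) false) ⟩
        sumTo n (λ i → b2n (is (inflate (block t) i (toℕ j)) false))  ≡⟨ inflate-colBalanced (h + b) (block t) (toℕ j) ⟩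
        sumTo n (λ i → b2n (is (inflate (block t) i (toℕ j)) true))   ≡⟨ count≡sumTo n (λ i → is (inflate (block t) i (toℕ j)) true) ⟨
        count (λ i → is (square t i j) true)                          ∎
    }
    where
    n = (h + b) * 2
    twistAt : Fin n → Fin n → Maybe Bool → Maybe Bool
    twistAt i j = twist (isOdd (toℕ i) xor isOdd (toℕ j))

  square-pairCount : ∀ t u {L} q →
    (∀ a a′ → count (λ r → (A r t ==ᵇ a) ∧ (A r u ==ᵇ a′)) ≡ L) →
    h * b + b * (h + b) ≡ q * c →
    ∀ a a′ → pairCount (square t) (square u) a a′ ≡ q * ((L + L) + (L + L))
  square-pairCount t u {L} q uniform blocks≡q*c a a′ = begin
    pairCount (square t) (square u) a a′
      ≡⟨ count2≡sumTo n (λ i j → is (inflate (block t) i j) a ∧ is (inflate (block u) i j) a′) ⟩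
    sumTo n (λ i → sumTo n (λ j → agrees a a′ (inflate (block t) i j) (inflate (block u) i j)))
      ≡⟨ inflate-agreements (h + b) (block t) (block u) a a′ ⟩
    sumTo (h + b) (λ I → sumTo (h + b) (λ J → blockAgreements a a′ (block t I J) (block u I J)))
      ≡⟨ sumTo-cong (h + b) (λ I _ → sumTo-cong (h + b) (λ J _ → blockAgreements-fill a a′ (isHoleBlock I J) _ _)) ⟩
    sumTo (h + b) (λ I → sumTo (h + b) (λ J → if isHoleBlock I J then 0 else rowAgreements (blockIndex I J mod c)))
      ≡⟨ sumTo-nonHoleBlocks (λ p → rowAgreements (p mod c)) ⟩
    sumTo (h * b + b * (h + b)) (λ p → rowAgreements (p mod c))
      ≡⟨ cong (λ N → sumTo N (λ p → rowAgreements (p mod c))) blocks≡q*c ⟩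
    sumTo (q * c) (λ p → rowAgreements (p mod c))
      ≡⟨ sumTo-mod q c rowAgreements ⟩
    q * sumFin rowAgreements
      ≡⟨ cong (q *_) (columnPair-agreements (λ r → A r t) (λ r → A r u) uniform a a′) ⟩
    q * ((L + L) + (L + L)) ∎
    where
    n = (h + b) * 2
    rowAgreements : Fin c → ℕ
    rowAgreements r = blockAgreements a a′ (just (A r t)) (just (A r u))

  imofs : ∀ {L} →
    (∀ t u → t ≢ u → ∀ a a′ → count (λ r → (A r t ==ᵇ a) ∧ (A r u ==ᵇ a′)) ≡ L) →
    c ∣ h * b + b * (h + b) →
    IMOFS k ((h + b) * 2) (h * 2)
  imofs uniform (divides q blocks≡q*c) = record
    { square     = square
    ; isIFS      = square-isIFS
    ; orthogonal = λ t u t≢u a a′ e e′ →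
        trans (square-pairCount t u q (uniform t u t≢u) blocks≡q*c a a′)
              (sym (square-pairCount t u q (uniform t u t≢u) blocks≡q*c e e′))
    }

orthogonalArray⇒IMOFS : ∀ h b {k lam} → 0 < b → OrthogonalArray k lam →
  4 * lam ∣ h * b + b * (h + b) → IMOFS k ((h + b) * 2) (h * 2)
orthogonalArray⇒IMOFS h b {k} {lam} 0<b (A , isOA) 4λ∣blocks@(divides q blocks≡q*4λ) =
  BlockConstruction.imofs h b {{4λ≢0}} A isOA 4λ∣blocks
  where
  blocks≢0 : NonZero (h * b + b * (h + b))
  blocks≢0 = >-nonZero (<-≤-trans (*-mono-< 0<b (<-≤-trans 0<b (m≤n+m b h))) (m≤n+m _ (h * b)))
  4λ≢0 : NonZero (4 * lam)
  4λ≢0 = m*n≢0⇒n≢0 q {{subst NonZero blocks≡q*4λ blocks≢0}}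

n≡[h+b]*2 : ∀ {n b} → 2 ∣ n → 2 * b < n → ∃[ h ] n ≡ (h + b) * 2
n≡[h+b]*2 {n} {b} (divides m n≡m*2) 2b<n = m ∸ b , trans n≡m*2 (cong (_* 2) (sym (m∸n+n≡m b≤m)))
  where
  b≤m : b ≤ m
  b≤m = <⇒≤ (*-cancelʳ-< 2 b m (subst₂ _<_ (*-comm 2 b) n≡m*2 2b<n))

[h+b]*2∸2*b≡h*2 : ∀ h b → (h + b) * 2 ∸ 2 * b ≡ h * 2
[h+b]*2∸2*b≡h*2 h b = trans (cong (_∸ 2 * b) (expand h b)) (m+n∸n≡m (h * 2) (2 * b))
  where
  expand : ∀ h b → (h + b) * 2 ≡ h * 2 + 2 * b
  expand = solve-∀

b*[[h+b]*2∸b]≡h*b+b*[h+b] : ∀ h b → b * ((h + b) * 2 ∸ b) ≡ h * b + b * (h + b)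
b*[[h+b]*2∸b]≡h*b+b*[h+b] h b = begin
  b * ((h + b) * 2 ∸ b)     ≡⟨ cong (λ x → b * (x ∸ b)) (expand h b) ⟩
  b * (h * 2 + b + b ∸ b)   ≡⟨ cong (b *_) (m+n∸n≡m (h * 2 + b) b) ⟩
  b * (h * 2 + b)           ≡⟨ regroup h b ⟩
  h * b + b * (h + b)       ∎
  where
  expand : ∀ h b → (h + b) * 2 ≡ h * 2 + b + b
  expand = solve-∀
  regroup : ∀ h b → b * (h * 2 + b) ≡ h * b + b * (h + b)
  regroup = solve-∀

theorem6p6 : ∀ (n b k lam : ℕ) →
    2 ∣ n → 0 < n → 0 < b → 2 * b < n →
    OrthogonalArray k lam →
    (4 * lam) ∣ (b * (n ∸ b)) →
    IMOFS k n (n ∸ 2 * b)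
theorem6p6 n b k lam 2∣n _ 0<b 2b<n oa 4λ∣b[n∸b] with h , refl ← n≡[h+b]*2 {b = b} 2∣n 2b<n =
  subst (IMOFS k ((h + b) * 2)) (sym ([h+b]*2∸2*b≡h*2 h b))
        (orthogonalArray⇒IMOFS h b 0<b oa (subst (4 * lam ∣_) (b*[[h+b]*2∸b]≡h*b+b*[h+b] h b) 4λ∣b[n∸b]))
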